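{- Let $X_n$ be one of $SE_n$, $A_n$, $R_n$, $S_n$ (with $X_k$ the corresponding set of length-$k$ sequences), let $1\le k<n$, let $a=a_1a_2\ldots a_k\in X_k$, and let $M=\omega_X(a)=\max\{x : ax\in X_{k+1}\}$. Let $s$ be the last (i.e. $\prec$-largest) sequence of $X_n$ having prefix $a$. Then: (i) if $\sum_{i=1}^k a_i$ is odd, $s=a00\ldots0$; (ii) if $\sum_{i=1}^k a_i$ is even and $M$ is odd, $s=aM0\ldots0$; (iii) if $\sum_{i=1}^k a_i$ is even and $M$ is even, $s=aM(M+1)0\ldots0$; where each displayed word is understood to be truncated to length $n$. The same holds for the first (i.e. $\prec$-smallest) sequence of $X_n$ having prefix $a$, with the words "odd" and "even" interchanged for the parity of $\sum_{i=1}^k a_i$.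
   Context: Statistics of $s_1\ldots s_k$: $\mathrm{len}=k-1$; $\mathrm{asc}=\#\{i<k: s_i<s_{i+1}\}$; $\max=\max_i s_i$; $\mathrm{lv}=s_k$. An $\mathrm{st}$-restricted growth sequence $s_1\ldots s_n$ satisfies $s_1=0$ and $0\le s_{k+1}\le \mathrm{st}(s_1\ldots s_k)+1$ for $1\le k<n$. $SE_n,A_n,R_n,S_n$ are the sets of length-$n$ such sequences for $\mathrm{st}=\mathrm{len},\mathrm{asc},\max,\mathrm{lv}$ respectively. Reflected Gray Code order: $s\prec t$ if, with $k$ the leftmost position where they differ, either $\sum_{i=1}^{k-1}s_i$ is even and $s_k<t_k$, or it is odd and $s_k>t_k$. -}

module Defs where

open import Data.Nat using (ℕ; zero; suc; _+_; _<_; _≤_; _⊔_; _∸_; _%_; _<ᵇ_)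
open import Data.Bool using (if_then_else_)
open import Data.Nat.ListAction using (sum)
open import Data.List using (List; []; _∷_; [_]; _++_; length)
open import Data.Product using (Σ; ∃; _×_; _,_)
open import Data.Sum using (_⊎_)
open import Relation.Binary.PropositionalEquality using (_≡_)

-- Statistics on a (nonempty) sequence s₁…s_k (values on [] are irrelevant).

lenSt : List ℕ → ℕ
lenSt s = length s ∸ 1

ascSt : List ℕ → ℕ
ascSt [] = 0
ascSt (x ∷ []) = 0
ascSt (x ∷ y ∷ r) = (if x <ᵇ y then 1 else 0) + ascSt (y ∷ r)

maxSt : List ℕ → ℕ
maxSt [] = 0
maxSt (x ∷ r) = x ⊔ maxSt r

lvSt : List ℕ → ℕ
lvSt [] = 0
lvSt (x ∷ []) = x
lvSt (x ∷ y ∷ r) = lvSt (y ∷ r)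

data Family : Set where
  SE A R S : Family

stat : Family → List ℕ → ℕ
stat SE = lenSt
stat A  = ascSt
stat R  = maxSt
stat S  = lvSt

data RGS (st : List ℕ → ℕ) : List ℕ → Set where
  start  : RGS st [ 0 ]
  extend : ∀ {s x} → RGS st s → x ≤ st s + 1 → RGS st (s ++ [ x ])

InX : Family → ℕ → List ℕ → Set
InX X n s = RGS (stat X) s × length s ≡ n

Prefix : List ℕ → List ℕ → Set
Prefix a s = ∃ λ u → s ≡ a ++ u

Even Odd : ℕ → Set
Even m = m % 2 ≡ 0
Odd  m = m % 2 ≡ 1

_≺_ : List ℕ → List ℕ → Set
s ≺ t = Σ (List ℕ) λ p → Σ ℕ λ x → Σ ℕ λ y → Σ (List ℕ) λ u → Σ (List ℕ) λ v →
  (s ≡ p ++ (x ∷ u)) × (t ≡ p ++ (y ∷ v)) ×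
  ((Even (sum p) × x < y) ⊎ (Odd (sum p) × y < x))

IsOmega : Family → List ℕ → ℕ → Set
IsOmega X a M = InX X (suc (length a)) (a ++ [ M ]) ×
  (∀ x → InX X (suc (length a)) (a ++ [ x ]) → x ≤ M)

IsLastWithPrefix : Family → ℕ → List ℕ → List ℕ → Set
IsLastWithPrefix X n a w = InX X n w × Prefix a w ×
  (∀ t → InX X n t → Prefix a t → (t ≡ w ⊎ t ≺ w))

IsFirstWithPrefix : Family → ℕ → List ℕ → List ℕ → Set
IsFirstWithPrefix X n a w = InX X n w × Prefix a w ×
  (∀ t → InX X n t → Prefix a t → (t ≡ w ⊎ w ≺ t))

-- Under the reflected Gray code order, the ≺-greatest extension of a prefix p is built
-- greedily: its next entry is the largest admissible value when Σp is even and 0 when Σp is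
-- odd. The largest admissible value after a is ω(a) = st(a) + 1, and each of the four
-- statistics is saturated by it: st(a ω(a)) = ω(a), so ω(a ω(a)) = ω(a) + 1. Once the prefix
-- sum is odd the greedy completion is all zeros; with an even sum it appends M = ω(a), which
-- keeps the sum even exactly when M is even, and then appends M + 1, which makes it odd.
-- The ≺-least extension is the same construction with the parities exchanged.
module Submission where

open import Data.Bool using (true; false; if_then_else_; T)
open import Data.Empty using (⊥-elim)
open import Data.List
  using (List; []; _∷_; [_]; _++_; length; take; replicate; initLast; _∷ʳ′_)
open import Data.List.Properties
  using (++-assoc; ++-identityʳ; ++-conicalˡ; ++-conicalʳ; ∷ʳ-injective; length-++; length-replicate)
open import Data.Nat using (ℕ; zero; suc; _+_; _∸_; _⊔_; _%_; _<ᵇ_; _≤_; _<_; z≤n; s≤s; z<s)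
open import Data.Nat.DivMod using (%-distribˡ-+)
open import Data.Nat.ListAction using (sum)
open import Data.Nat.ListAction.Properties using (sum-++)
open import Data.Nat.Properties
open import Data.Product using (∃; _×_; _,_; proj₁)
open import Data.Sum using (_⊎_; inj₁; inj₂)
open import Relation.Binary.PropositionalEquality
  using (_≡_; _≢_; refl; sym; trans; cong; subst; subst₂)

open import Defs

private
  variable
    B : Set

+-parity : ∀ x y {i j} → x % 2 ≡ i → y % 2 ≡ j → (x + y) % 2 ≡ (i + j) % 2
+-parity x y refl refl = %-distribˡ-+ x y 2

sum-∷ʳ-parity : ∀ p x {i j} → sum p % 2 ≡ i → x % 2 ≡ j → sum (p ++ [ x ]) % 2 ≡ (i + j) % 2
sum-∷ʳ-parity p x p%2 x%2 rewrite sum-++ p [ x ] | +-identityʳ x = +-parity (sum p) x p%2 x%2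

odd-suc : ∀ m → Even m → Odd (suc m)
odd-suc m = +-parity 1 m refl

∷ʳ-≢[] : ∀ (p : List B) {x} → p ++ [ x ] ≢ []
∷ʳ-≢[] p eq with ++-conicalʳ p _ eq
... | ()

length-∷ʳ : ∀ (p : List B) {x} → length (p ++ [ x ]) ≡ suc (length p)
length-∷ʳ p = trans (length-++ p) (+-comm (length p) 1)

length-∷ʳ-+ : ∀ (p : List B) {x} j → length (p ++ [ x ]) + j ≡ length p + suc j
length-∷ʳ-+ p j = trans (cong (_+ j) (length-∷ʳ p)) (sym (+-suc (length p) j))

length-suffix : ∀ (p : List B) {u j} → length (p ++ u) ≡ length p + j → length u ≡ j
length-suffix p eq = +-cancelˡ-≡ (length p) _ _ (trans (sym (length-++ p)) eq)

full-length-extension : ∀ (p : List B) {u} → length (p ++ u) ≡ length p + 0 → p ++ u ≡ p ++ []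
full-length-extension p {[]} _ = refl
full-length-extension p {_ ∷ _} eq with length-suffix p eq
... | ()

proper-extension-longer : ∀ (p : List B) {x v} → length (p ++ []) ≢ length (p ++ x ∷ v)
proper-extension-longer p eq with length-suffix p (trans eq (length-++ p))
... | ()

take-++ˡ : ∀ (a : List B) {v} j → take (length a + j) (a ++ v) ≡ a ++ take j v
take-++ˡ []      j = refl
take-++ˡ (x ∷ a) j = cong (x ∷_) (take-++ˡ a j)

take-padding : ∀ (c : List B) {x j n} → length c ≤ j → j ≤ n →
               take j (c ++ replicate n x) ≡ c ++ replicate (j ∸ length c) x
take-padding []      {j = zero}          _         _         = refl
take-padding []      {j = suc j} {suc n} _         (s≤s j≤n) = cong (_ ∷_) (take-padding [] z≤n j≤n)
take-padding (y ∷ c) {j = suc j}         (s≤s c≤j) j<n       = cong (y ∷_) (take-padding c c≤j (<⇒≤ j<n))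

AdmitsAtMost : (List ℕ → ℕ) → List ℕ → ℕ → Set
AdmitsAtMost st p m = ∀ x → RGS st (p ++ [ x ]) → x ≤ m

module _ {st : List ℕ → ℕ} where

  RGS-nonempty : ∀ {s} → RGS st s → s ≢ []
  RGS-nonempty start          = λ ()
  RGS-nonempty (extend {s} _ _) = ∷ʳ-≢[] s

  RGS-++-zeros : ∀ {s} → RGS st s → ∀ j → RGS st (s ++ replicate j 0)
  RGS-++-zeros {s} rs zero    = subst (RGS st) (sym (++-identityʳ s)) rs
  RGS-++-zeros {s} rs (suc j) = subst (RGS st) (++-assoc s [ 0 ] _) (RGS-++-zeros (extend rs z≤n) j)

  RGS-prefix : ∀ {s} p {q} → RGS st s → s ≡ p ++ q → p ≢ [] → RGS st p
  RGS-prefix p {q} rs eq p≢[] with initLast q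
  ... | [] = subst (RGS st) (trans eq (++-identityʳ p)) rs
  RGS-prefix p start eq p≢[] | q ∷ʳ′ y = ⊥-elim (p≢[] (++-conicalˡ p q (sym []≡p++q)))
    where
    []≡p++q : [] ≡ p ++ q
    []≡p++q = proj₁ (∷ʳ-injective [] (p ++ q) (trans eq (sym (++-assoc p q [ y ]))))
  RGS-prefix p (extend rs _) eq p≢[] | q ∷ʳ′ y =
    RGS-prefix p rs (proj₁ (∷ʳ-injective _ (p ++ q) (trans eq (sym (++-assoc p q [ y ]))))) p≢[]

  admitsAtMost-st+1 : ∀ {p} → p ≢ [] → AdmitsAtMost st p (st p + 1)
  admitsAtMost-st+1 {p} p≢[] x rpx = bound rpx refl
    where
    bound : ∀ {s} → RGS st s → s ≡ p ++ [ x ] → x ≤ st p + 1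
    bound start eq = ⊥-elim (p≢[] (sym (proj₁ (∷ʳ-injective [] p eq))))
    bound (extend _ x≤) eq with ∷ʳ-injective _ p eq
    ... | refl , refl = x≤

Saturating : (List ℕ → ℕ) → Set
Saturating st = ∀ {s} → RGS st s → st (s ++ [ st s + 1 ]) ≡ st s + 1

lvSt-∷ʳ : ∀ s x → lvSt (s ++ [ x ]) ≡ x
lvSt-∷ʳ []          x = refl
lvSt-∷ʳ (y ∷ [])    x = refl
lvSt-∷ʳ (y ∷ z ∷ s) x = lvSt-∷ʳ (z ∷ s) x

maxSt-∷ʳ : ∀ s x → maxSt (s ++ [ x ]) ≡ maxSt s ⊔ x
maxSt-∷ʳ []      x = ⊔-identityʳ x
maxSt-∷ʳ (y ∷ s) x = trans (cong (y ⊔_) (maxSt-∷ʳ s x)) (sym (⊔-assoc y (maxSt s) x))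

ascSt-∷ʳ : ∀ s x → s ≢ [] → ascSt (s ++ [ x ]) ≡ ascSt s + (if lvSt s <ᵇ x then 1 else 0)
ascSt-∷ʳ []          x s≢[] = ⊥-elim (s≢[] refl)
ascSt-∷ʳ (y ∷ [])    x _    = +-comm (if y <ᵇ x then 1 else 0) 0
ascSt-∷ʳ (y ∷ z ∷ s) x _ rewrite ascSt-∷ʳ (z ∷ s) x (λ ()) =
  sym (+-assoc (if y <ᵇ z then 1 else 0) (ascSt (z ∷ s)) _)

lvSt≤ascSt : ∀ {s} → RGS ascSt s → lvSt s ≤ ascSt s
lvSt≤ascSt start = z≤n
lvSt≤ascSt (extend {s} {x} rs x≤) rewrite lvSt-∷ʳ s x | ascSt-∷ʳ s x (RGS-nonempty rs)
  with lvSt s <ᵇ x in lv<ᵇx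
... | true  = x≤
... | false = ≤-trans (≮⇒≥ λ lv<x → subst T lv<ᵇx (<⇒<ᵇ lv<x))
                      (≤-trans (lvSt≤ascSt rs) (m≤m+n _ 0))

stat-saturating : ∀ X → Saturating (stat X)
stat-saturating SE {[]}    rs = ⊥-elim (RGS-nonempty rs refl)
stat-saturating SE {y ∷ s} _  = length-++ s
stat-saturating R  {s}     _  = trans (maxSt-∷ʳ s _) (m≤n⇒m⊔n≡n (m≤m+n (maxSt s) 1))
stat-saturating S  {s}     _  = lvSt-∷ʳ s _
stat-saturating A  {s}     rs rewrite ascSt-∷ʳ s (ascSt s + 1) (RGS-nonempty rs)
  with lvSt s <ᵇ ascSt s + 1 in lv<ᵇ
... | true  = refl
... | false = ⊥-elim (subst T lv<ᵇ (<⇒<ᵇ (≤-<-trans (lvSt≤ascSt rs) (m<m+n (ascSt s) z<s))))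

infix 4 _≼_ _≽_

_≼_ _≽_ : List ℕ → List ℕ → Set
s ≼ t = s ≡ t ⊎ s ≺ t
s ≽ t = s ≡ t ⊎ t ≺ s

zeros-greatest : ∀ {p} → Odd (sum p) → ∀ u → p ++ u ≼ p ++ replicate (length u) 0
zeros-greatest     o []          = inj₁ refl
zeros-greatest {p} o (zero ∷ u)  =
  subst₂ _≼_ (++-assoc p [ 0 ] u) (++-assoc p [ 0 ] _)
    (zeros-greatest (sum-∷ʳ-parity p 0 o refl) u)
zeros-greatest {p} o (suc x ∷ u) = inj₂ (p , suc x , 0 , u , _ , refl , refl , inj₂ (o , z<s))

zeros-least : ∀ {p} → Even (sum p) → ∀ u → p ++ u ≽ p ++ replicate (length u) 0
zeros-least     e []          = inj₁ refl
zeros-least {p} e (zero ∷ u)  =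
  subst₂ _≽_ (++-assoc p [ 0 ] u) (++-assoc p [ 0 ] _)
    (zeros-least (sum-∷ʳ-parity p 0 e refl) u)
zeros-least {p} e (suc x ∷ u) = inj₂ (p , 0 , suc x , _ , u , refl , refl , inj₁ (e , z<s))

RGSₙ : (List ℕ → ℕ) → ℕ → List ℕ → Set
RGSₙ st n s = RGS st s × length s ≡ n

LastWithPrefix FirstWithPrefix : (List ℕ → ℕ) → ℕ → List ℕ → List ℕ → Set
LastWithPrefix  st n a w = RGSₙ st n w × Prefix a w × (∀ t → RGSₙ st n t → Prefix a t → t ≼ w)
FirstWithPrefix st n a w = RGSₙ st n w × Prefix a w × (∀ t → RGSₙ st n t → Prefix a t → t ≽ w)

module _ {st : List ℕ → ℕ} where

  RGSₙ-++-zeros : ∀ {p} → RGS st p → ∀ j → RGSₙ st (length p + j) (p ++ replicate j 0)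
  RGSₙ-++-zeros {p} rp j =
    RGS-++-zeros rp j , trans (length-++ p) (cong (length p +_) (length-replicate j))

  zeros-last : ∀ {p n} → RGS st p → Odd (sum p) → ∀ j → length p + j ≡ n →
               LastWithPrefix st n p (p ++ replicate j 0)
  zeros-last {p} rp o j refl = RGSₙ-++-zeros rp j , (_ , refl) , λ where
    _ (_ , lt) (u , refl) →
      subst (λ i → p ++ u ≼ p ++ replicate i 0) (length-suffix p lt) (zeros-greatest o u)

  zeros-first : ∀ {p n} → RGS st p → Even (sum p) → ∀ j → length p + j ≡ n →
                FirstWithPrefix st n p (p ++ replicate j 0)
  zeros-first {p} rp e j refl = RGSₙ-++-zeros rp j , (_ , refl) , λ where
    _ (_ , lt) (u , refl) →
      subst (λ i → p ++ u ≽ p ++ replicate i 0) (length-suffix p lt) (zeros-least e u)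

  -- Stated for p ++ [] so that it feeds last-step / first-step with v = [].
  whole-last : ∀ {p n} → RGS st p → length p + 0 ≡ n → LastWithPrefix st n p (p ++ [])
  whole-last {p} rp refl = RGSₙ-++-zeros rp 0 , (_ , refl) , λ where
    _ (_ , lt) (_ , refl) → inj₁ (full-length-extension p lt)

  whole-first : ∀ {p n} → RGS st p → length p + 0 ≡ n → FirstWithPrefix st n p (p ++ [])
  whole-first {p} rp refl = RGSₙ-++-zeros rp 0 , (_ , refl) , λ where
    _ (_ , lt) (_ , refl) → inj₁ (full-length-extension p lt)

  last-step : ∀ {p m v n} → p ≢ [] → Even (sum p) → AdmitsAtMost st p m →
              LastWithPrefix st n (p ++ [ m ]) ((p ++ [ m ]) ++ v) →
              LastWithPrefix st n p (p ++ m ∷ v)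
  last-step {p} {m} {v} {n} p≢[] e bound ((rw , lw) , _ , greatest) =
    (subst (RGS st) reassoc rw , lw′) , (m ∷ v , refl) , compare
    where
    reassoc : (p ++ [ m ]) ++ v ≡ p ++ m ∷ v
    reassoc = ++-assoc p [ m ] v
    lw′ : length (p ++ m ∷ v) ≡ n
    lw′ = trans (cong length (sym reassoc)) lw
    compare : ∀ t → RGSₙ st n t → Prefix p t → t ≼ p ++ m ∷ v
    compare _ (_ , lt) ([] , refl) = ⊥-elim (proper-extension-longer p (trans lt (sym lw′)))
    compare _ (rt , lt) (x ∷ u , refl)
      with m≤n⇒m<n∨m≡n (bound x (RGS-prefix (p ++ [ x ]) rt (sym (++-assoc p [ x ] u)) (∷ʳ-≢[] p)))
    ... | inj₁ x<m = inj₂ (p , x , m , u , v , refl , refl , inj₁ (e , x<m))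
    ... | inj₂ refl =
      subst (p ++ m ∷ u ≼_) reassoc (greatest _ (rt , lt) (u , sym (++-assoc p [ m ] u)))

  first-step : ∀ {p m v n} → p ≢ [] → Odd (sum p) → AdmitsAtMost st p m →
               FirstWithPrefix st n (p ++ [ m ]) ((p ++ [ m ]) ++ v) →
               FirstWithPrefix st n p (p ++ m ∷ v)
  first-step {p} {m} {v} {n} p≢[] o bound ((rw , lw) , _ , least) =
    (subst (RGS st) reassoc rw , lw′) , (m ∷ v , refl) , compare
    where
    reassoc : (p ++ [ m ]) ++ v ≡ p ++ m ∷ v
    reassoc = ++-assoc p [ m ] v
    lw′ : length (p ++ m ∷ v) ≡ n
    lw′ = trans (cong length (sym reassoc)) lw
    compare : ∀ t → RGSₙ st n t → Prefix p t → t ≽ p ++ m ∷ v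
    compare _ (_ , lt) ([] , refl) = ⊥-elim (proper-extension-longer p (trans lt (sym lw′)))
    compare _ (rt , lt) (x ∷ u , refl)
      with m≤n⇒m<n∨m≡n (bound x (RGS-prefix (p ++ [ x ]) rt (sym (++-assoc p [ x ] u)) (∷ʳ-≢[] p)))
    ... | inj₁ x<m = inj₂ (p , m , x , v , u , refl , refl , inj₂ (o , x<m))
    ... | inj₂ refl =
      subst (p ++ m ∷ u ≽_) reassoc (least _ (rt , lt) (u , sym (++-assoc p [ m ] u)))

module Greedy {st : List ℕ → ℕ} (saturating : Saturating st) {a : List ℕ} (ra : RGS st a) where

  ω : ℕ
  ω = st a + 1

  a≢[] : a ≢ []
  a≢[] = RGS-nonempty ra

  ω-after-ω : suc ω ≡ st (a ++ [ ω ]) + 1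
  ω-after-ω = trans (+-comm 1 ω) (cong (_+ 1) (sym (saturating ra)))

  raω : RGS st (a ++ [ ω ])
  raω = extend ra ≤-refl

  raωω : RGS st ((a ++ [ ω ]) ++ [ suc ω ])
  raωω = extend raω (≤-reflexive ω-after-ω)

  a-admits : AdmitsAtMost st a ω
  a-admits = admitsAtMost-st+1 a≢[]

  aω-admits : AdmitsAtMost st (a ++ [ ω ]) (suc ω)
  aω-admits =
    subst (AdmitsAtMost st (a ++ [ ω ])) (sym ω-after-ω) (admitsAtMost-st+1 (∷ʳ-≢[] a))

  N : ℕ → ℕ
  N j = length a + suc j

  padded : ℕ → List ℕ → List ℕ
  padded j c = take (N j) (a ++ c ++ replicate (N j) 0)

  padded-≡ : ∀ j c → length c ≤ suc j → padded j c ≡ a ++ c ++ replicate (suc j ∸ length c) 0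
  padded-≡ j c c≤ =
    trans (take-++ˡ a (suc j)) (cong (a ++_) (take-padding c c≤ (m≤n+m (suc j) (length a))))

  length-aωω : ∀ i → length ((a ++ [ ω ]) ++ [ suc ω ]) + i ≡ N (suc i)
  length-aωω i = trans (length-∷ʳ-+ (a ++ [ ω ]) i) (length-∷ʳ-+ a (suc i))

  last-zeros : ∀ j → Odd (sum a) → LastWithPrefix st (N j) a (padded j [])
  last-zeros j o =
    subst (LastWithPrefix st (N j) a) (sym (padded-≡ j [] z≤n)) (zeros-last ra o (suc j) refl)

  last-ω-zeros : ∀ j → Even (sum a) → Odd ω → LastWithPrefix st (N j) a (padded j [ ω ])
  last-ω-zeros j e o = subst (LastWithPrefix st (N j) a) (sym (padded-≡ j [ ω ] (s≤s z≤n)))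
    (last-step a≢[] e a-admits (zeros-last raω (sum-∷ʳ-parity a ω e o) j (length-∷ʳ-+ a j)))

  last-ω-suc-zeros : ∀ j → Even (sum a) → Even ω →
                     LastWithPrefix st (N j) a (padded j (ω ∷ suc ω ∷ []))
  last-ω-suc-zeros zero e _ = subst (LastWithPrefix st (N 0) a) (sym (take-++ˡ a 1))
    (last-step a≢[] e a-admits (whole-last raω (length-∷ʳ-+ a 0)))
  last-ω-suc-zeros (suc i) e e′ =
    subst (LastWithPrefix st (N (suc i)) a) (sym (padded-≡ (suc i) _ (s≤s (s≤s z≤n))))
      (last-step a≢[] e a-admits
        (last-step (∷ʳ-≢[] a) eω aω-admits (zeros-last raωω oωω i (length-aωω i))))
    where
    eω : Even (sum (a ++ [ ω ]))
    eω = sum-∷ʳ-parity a ω e e′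
    oωω : Odd (sum ((a ++ [ ω ]) ++ [ suc ω ]))
    oωω = sum-∷ʳ-parity (a ++ [ ω ]) (suc ω) eω (odd-suc ω e′)

  first-zeros : ∀ j → Even (sum a) → FirstWithPrefix st (N j) a (padded j [])
  first-zeros j e =
    subst (FirstWithPrefix st (N j) a) (sym (padded-≡ j [] z≤n)) (zeros-first ra e (suc j) refl)

  first-ω-zeros : ∀ j → Odd (sum a) → Odd ω → FirstWithPrefix st (N j) a (padded j [ ω ])
  first-ω-zeros j o o′ = subst (FirstWithPrefix st (N j) a) (sym (padded-≡ j [ ω ] (s≤s z≤n)))
    (first-step a≢[] o a-admits (zeros-first raω (sum-∷ʳ-parity a ω o o′) j (length-∷ʳ-+ a j)))

  first-ω-suc-zeros : ∀ j → Odd (sum a) → Even ω →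
                      FirstWithPrefix st (N j) a (padded j (ω ∷ suc ω ∷ []))
  first-ω-suc-zeros zero o _ = subst (FirstWithPrefix st (N 0) a) (sym (take-++ˡ a 1))
    (first-step a≢[] o a-admits (whole-first raω (length-∷ʳ-+ a 0)))
  first-ω-suc-zeros (suc i) o e =
    subst (FirstWithPrefix st (N (suc i)) a) (sym (padded-≡ (suc i) _ (s≤s (s≤s z≤n))))
      (first-step a≢[] o a-admits
        (first-step (∷ʳ-≢[] a) oω aω-admits (zeros-first raωω eωω i (length-aωω i))))
    where
    oω : Odd (sum (a ++ [ ω ]))
    oω = sum-∷ʳ-parity a ω o e
    eωω : Even (sum ((a ++ [ ω ]) ++ [ suc ω ]))
    eωω = sum-∷ʳ-parity (a ++ [ ω ]) (suc ω) oω (odd-suc ω e)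

ω≡stat+1 : ∀ {X a M} → RGS (stat X) a → IsOmega X a M → M ≡ stat X a + 1
ω≡stat+1 {a = a} ra ((raM , _) , maximal) =
  ≤-antisym (admitsAtMost-st+1 (RGS-nonempty ra) _ raM)
            (maximal _ (extend ra ≤-refl , length-∷ʳ a))

<⇒≡+suc : ∀ {k n} → k < n → ∃ λ j → n ≡ k + suc j
<⇒≡+suc {k} k<n with m≤n⇒∃[o]m+o≡n k<n
... | j , refl = j , sym (+-suc k j)

proposition1 : (X : Family) (n k : ℕ) → 1 ≤ k → k < n →
    (a : List ℕ) → InX X k a → (M : ℕ) → IsOmega X a M →
    ((Odd (sum a) → IsLastWithPrefix X n a (take n (a ++ replicate n 0))) ×
     (Even (sum a) → Odd M → IsLastWithPrefix X n a (take n (a ++ (M ∷ replicate n 0)))) ×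
     (Even (sum a) → Even M → IsLastWithPrefix X n a (take n (a ++ (M ∷ suc M ∷ replicate n 0))))) ×
    ((Even (sum a) → IsFirstWithPrefix X n a (take n (a ++ replicate n 0))) ×
     (Odd (sum a) → Odd M → IsFirstWithPrefix X n a (take n (a ++ (M ∷ replicate n 0)))) ×
     (Odd (sum a) → Even M → IsFirstWithPrefix X n a (take n (a ++ (M ∷ suc M ∷ replicate n 0)))))
proposition1 X n k _ k<n a (ra , refl) M isω with <⇒≡+suc k<n | ω≡stat+1 {X} ra isω
... | j , refl | refl =
  (last-zeros j , last-ω-zeros j , last-ω-suc-zeros j) ,
  (first-zeros j , first-ω-zeros j , first-ω-suc-zeros j)
  where open Greedy (stat-saturating X) ra
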